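{- Let $A$ be a BL-algebra. Every morphism-state-operator $\sigma$ on $A$ is a strong state-operator on $A$ (i.e. every state-morphism BL-algebra is a strong state BL-algebra). The converse fails in general: there exist a BL-algebra $A$ and a strong state-operator on $A$ which is not a morphism-state-operator.
   Context: A BL-algebra is an algebra $(A,\wedge,\vee,\odot,\to,0,1)$ of type $(2,2,2,2,0,0)$ such that $(A,\wedge,\vee,0,1)$ is a bounded lattice, $(A,\odot,1)$ is a commutative monoid, and for all $a,b,c\in A$: $c\le a\to b$ iff $a\odot c\le b$; $a\wedge b=a\odot(a\to b)$; $(a\to b)\vee(b\to a)=1$. Write $x^-:=x\to 0$. Consider the conditions, for all $x,y\in A$: (1) $\sigma(0)=0$; (2) $\sigma(x\to y)=\sigma(x)\to\sigma(x\wedge y)$; (3') $\sigma(x\odot y)=\sigma(x)\odot\sigma(x^-\vee y)$; (4) $\sigma(\sigma(x)\odot\sigma(y))=\sigma(x)\odot\sigma(y)$; (5) $\sigma(\sigma(x)\to\sigma(y))=\sigma(x)\to\sigma(y)$; (6) $\sigma(x\odot y)=\sigma(x)\odot\sigma(y)$. A strong state-operator is a map $\sigma:A\to A$ satisfying (1), (2), (3'), (4), (5). A morphism-state-operator is a map $\sigma:A\to A$ satisfying (1), (2), (4), (5), (6); then $(A,\sigma)$ is called a state-morphism BL-algebra. -}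

module Defs where

open import Level using (Level; suc; _⊔_)
open import Relation.Binary.PropositionalEquality using (_≡_)
open import Data.Product using (_×_)
open import Function.Bundles using (_⇔_)

record BLAlgebra (a : Level) : Set (suc a) where
  infixr 6 _∨_
  infixr 7 _∧_
  infixr 7 _⊙_
  infixr 5 _⇒_
  infix 4 _≤_
  field
    Carrier : Set a
    _∧_ _∨_ _⊙_ _⇒_ : Carrier → Carrier → Carrier
    𝟘 𝟙 : Carrier

  _≤_ : Carrier → Carrier → Set a
  x ≤ y = x ∧ y ≡ x

  field
    ∧-comm    : ∀ x y → x ∧ y ≡ y ∧ x
    ∨-comm    : ∀ x y → x ∨ y ≡ y ∨ x
    ∧-assoc   : ∀ x y z → (x ∧ y) ∧ z ≡ x ∧ (y ∧ z)
    ∨-assoc   : ∀ x y z → (x ∨ y) ∨ z ≡ x ∨ (y ∨ z)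
    ∧-absorbs-∨ : ∀ x y → x ∧ (x ∨ y) ≡ x
    ∨-absorbs-∧ : ∀ x y → x ∨ (x ∧ y) ≡ x
    𝟘-least   : ∀ x → 𝟘 ≤ x
    𝟙-greatest : ∀ x → x ≤ 𝟙
    ⊙-comm    : ∀ x y → x ⊙ y ≡ y ⊙ x
    ⊙-assoc   : ∀ x y z → (x ⊙ y) ⊙ z ≡ x ⊙ (y ⊙ z)
    ⊙-identityʳ : ∀ x → x ⊙ 𝟙 ≡ x
    residuation : ∀ x y z → (z ≤ x ⇒ y) ⇔ (x ⊙ z ≤ y)
    divisibility : ∀ x y → x ∧ y ≡ x ⊙ (x ⇒ y)
    prelinearity : ∀ x y → (x ⇒ y) ∨ (y ⇒ x) ≡ 𝟙

  _⁻ : Carrier → Carrier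
  x ⁻ = x ⇒ 𝟘

module _ {a : Level} (A : BLAlgebra a) where
  open BLAlgebra A

  Cond1 : (Carrier → Carrier) → Set a
  Cond1 σ = σ 𝟘 ≡ 𝟘

  Cond2 : (Carrier → Carrier) → Set a
  Cond2 σ = ∀ x y → σ (x ⇒ y) ≡ σ x ⇒ σ (x ∧ y)

  Cond3' : (Carrier → Carrier) → Set a
  Cond3' σ = ∀ x y → σ (x ⊙ y) ≡ σ x ⊙ σ (x ⁻ ∨ y)

  Cond4 : (Carrier → Carrier) → Set a
  Cond4 σ = ∀ x y → σ (σ x ⊙ σ y) ≡ σ x ⊙ σ y

  Cond5 : (Carrier → Carrier) → Set a
  Cond5 σ = ∀ x y → σ (σ x ⇒ σ y) ≡ σ x ⇒ σ y

  Cond6 : (Carrier → Carrier) → Set a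
  Cond6 σ = ∀ x y → σ (x ⊙ y) ≡ σ x ⊙ σ y

  IsStrongStateOperator : (Carrier → Carrier) → Set a
  IsStrongStateOperator σ = Cond1 σ × Cond2 σ × Cond3' σ × Cond4 σ × Cond5 σ

  IsMorphismStateOperator : (Carrier → Carrier) → Set a
  IsMorphismStateOperator σ = Cond1 σ × Cond2 σ × Cond4 σ × Cond5 σ × Cond6 σ

-- By distributivity of ⊙ over ∨ and x ⊙ x⁻ = 0 one has
-- x ⊙ (x⁻ ∨ y) = x ⊙ y, so (3') is (6) applied to x and x⁻ ∨ y.
-- For the converse take the square [0,1]ℚ × [0,1]ℚ of Łukasiewicz chains and let
-- σ send (a, b) to the diagonal point ((a+b)/2, (a+b)/2).  In a Łukasiewicz chain
-- x → y = (1 - x) + (x ∧ y) and x ⊙ y = x + (x⁻ ∨ y) - 1, so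
-- → and ⊙ are affine in exactly the lattice terms occurring in (2) and (3'), and
-- averaging commutes with them.  Averaging is not multiplicative, though:
-- σ((1,0) ⊙ (1,0)) = (½,½) while σ(1,0) ⊙ σ(1,0) = (½ ⊙ ½, ½ ⊙ ½) = (0,0).
module Submission where

open import Defs
open import Level using (Level; 0ℓ)
open import Data.Product using (_×_; Σ; _,_; proj₁; proj₂)
open import Relation.Nullary using (¬_)
open import Relation.Binary.PropositionalEquality
open import Function.Bundles using (Equivalence; mk⇔)

module BLAlgebraProperties {a : Level} (A : BLAlgebra a) where
  open BLAlgebra A

  ∧-idem : ∀ x → x ∧ x ≡ x
  ∧-idem x = begin
    x ∧ x             ≡⟨ cong (x ∧_) (sym (∨-absorbs-∧ x x)) ⟩
    x ∧ (x ∨ x ∧ x)   ≡⟨ ∧-absorbs-∨ x (x ∧ x) ⟩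
    x                 ∎
    where open ≡-Reasoning

  ≤-refl : ∀ {x} → x ≤ x
  ≤-refl {x} = ∧-idem x

  ≤-trans : ∀ {x y z} → x ≤ y → y ≤ z → x ≤ z
  ≤-trans {x} {y} {z} x≤y y≤z = begin
    x ∧ z         ≡⟨ cong (_∧ z) (sym x≤y) ⟩
    (x ∧ y) ∧ z   ≡⟨ ∧-assoc x y z ⟩
    x ∧ (y ∧ z)   ≡⟨ cong (x ∧_) y≤z ⟩
    x ∧ y         ≡⟨ x≤y ⟩
    x             ∎
    where open ≡-Reasoning

  ≤-antisym : ∀ {x y} → x ≤ y → y ≤ x → x ≡ y
  ≤-antisym {x} {y} x≤y y≤x = trans (sym x≤y) (trans (∧-comm x y) y≤x)

  x≤y⇒x∨y≡y : ∀ {x y} → x ≤ y → x ∨ y ≡ y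
  x≤y⇒x∨y≡y {x} {y} x≤y = begin
    x ∨ y         ≡⟨ cong (_∨ y) (trans (sym x≤y) (∧-comm x y)) ⟩
    y ∧ x ∨ y     ≡⟨ ∨-comm (y ∧ x) y ⟩
    y ∨ y ∧ x     ≡⟨ ∨-absorbs-∧ y x ⟩
    y             ∎
    where open ≡-Reasoning

  x≤x∨y : ∀ x y → x ≤ x ∨ y
  x≤x∨y = ∧-absorbs-∨

  y≤x∨y : ∀ x y → y ≤ x ∨ y
  y≤x∨y x y = subst (y ≤_) (∨-comm y x) (x≤x∨y y x)

  ∨-lub : ∀ {x y z} → x ≤ z → y ≤ z → x ∨ y ≤ z
  ∨-lub {x} {y} {z} x≤z y≤z = begin
    (x ∨ y) ∧ z             ≡⟨ cong ((x ∨ y) ∧_) (sym ∨≡z) ⟩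
    (x ∨ y) ∧ ((x ∨ y) ∨ z) ≡⟨ ∧-absorbs-∨ (x ∨ y) z ⟩
    x ∨ y                   ∎
    where
      open ≡-Reasoning
      ∨≡z : (x ∨ y) ∨ z ≡ z
      ∨≡z = trans (∨-assoc x y z) (trans (cong (x ∨_) (x≤y⇒x∨y≡y y≤z)) (x≤y⇒x∨y≡y x≤z))

  residuation-to : ∀ {x y z} → z ≤ x ⇒ y → x ⊙ z ≤ y
  residuation-to {x} {y} {z} = Equivalence.to (residuation x y z)

  residuation-from : ∀ {x y z} → x ⊙ z ≤ y → z ≤ x ⇒ y
  residuation-from {x} {y} {z} = Equivalence.from (residuation x y z)

  ⊙-monoʳ-≤ : ∀ x {y z} → y ≤ z → x ⊙ y ≤ x ⊙ z
  ⊙-monoʳ-≤ x y≤z = residuation-to (≤-trans y≤z (residuation-from ≤-refl))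

  ⊙-distribˡ-∨ : ∀ x y z → x ⊙ (y ∨ z) ≡ x ⊙ y ∨ x ⊙ z
  ⊙-distribˡ-∨ x y z = ≤-antisym
    (residuation-to (∨-lub (residuation-from (x≤x∨y (x ⊙ y) (x ⊙ z)))
                           (residuation-from (y≤x∨y (x ⊙ y) (x ⊙ z)))))
    (∨-lub (⊙-monoʳ-≤ x (x≤x∨y y z)) (⊙-monoʳ-≤ x (y≤x∨y y z)))

  x⊙x⁻≡𝟘 : ∀ x → x ⊙ x ⁻ ≡ 𝟘
  x⊙x⁻≡𝟘 x = ≤-antisym (residuation-to ≤-refl) (𝟘-least (x ⊙ x ⁻))

  x⊙[x⁻∨y]≡x⊙y : ∀ x y → x ⊙ (x ⁻ ∨ y) ≡ x ⊙ y
  x⊙[x⁻∨y]≡x⊙y x y = begin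
    x ⊙ (x ⁻ ∨ y)       ≡⟨ ⊙-distribˡ-∨ x (x ⁻) y ⟩
    x ⊙ x ⁻ ∨ x ⊙ y     ≡⟨ cong (_∨ x ⊙ y) (x⊙x⁻≡𝟘 x) ⟩
    𝟘 ∨ x ⊙ y           ≡⟨ x≤y⇒x∨y≡y (𝟘-least (x ⊙ y)) ⟩
    x ⊙ y               ∎
    where open ≡-Reasoning

morphismState⇒strongState : ∀ {a} (A : BLAlgebra a) (σ : BLAlgebra.Carrier A → BLAlgebra.Carrier A) →
                            IsMorphismStateOperator A σ → IsStrongStateOperator A σ
morphismState⇒strongState A σ (σ𝟘 , σ⇒ , σσ⊙ , σσ⇒ , σ⊙) = σ𝟘 , σ⇒ , σ-cond3' , σσ⊙ , σσ⇒
  where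
    open BLAlgebra A
    open BLAlgebraProperties A
    σ-cond3' : Cond3' A σ
    σ-cond3' x y = trans (cong σ (sym (x⊙[x⁻∨y]≡x⊙y x y))) (σ⊙ x (x ⁻ ∨ y))

infixr 2 _×ᴮᴸ_
_×ᴮᴸ_ : ∀ {a} → BLAlgebra a → BLAlgebra a → BLAlgebra a
A ×ᴮᴸ B = record
  { Carrier      = A.Carrier × B.Carrier
  ; _∧_ = λ x y → x .proj₁ A.∧ y .proj₁ , x .proj₂ B.∧ y .proj₂
  ; _∨_ = λ x y → x .proj₁ A.∨ y .proj₁ , x .proj₂ B.∨ y .proj₂
  ; _⊙_ = λ x y → x .proj₁ A.⊙ y .proj₁ , x .proj₂ B.⊙ y .proj₂
  ; _⇒_ = λ x y → x .proj₁ A.⇒ y .proj₁ , x .proj₂ B.⇒ y .proj₂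
  ; 𝟘 = A.𝟘 , B.𝟘 ; 𝟙 = A.𝟙 , B.𝟙
  ; ∧-comm       = λ x y → cong₂ _,_ (A.∧-comm _ _) (B.∧-comm _ _)
  ; ∨-comm       = λ x y → cong₂ _,_ (A.∨-comm _ _) (B.∨-comm _ _)
  ; ∧-assoc      = λ x y z → cong₂ _,_ (A.∧-assoc _ _ _) (B.∧-assoc _ _ _)
  ; ∨-assoc      = λ x y z → cong₂ _,_ (A.∨-assoc _ _ _) (B.∨-assoc _ _ _)
  ; ∧-absorbs-∨  = λ x y → cong₂ _,_ (A.∧-absorbs-∨ _ _) (B.∧-absorbs-∨ _ _)
  ; ∨-absorbs-∧  = λ x y → cong₂ _,_ (A.∨-absorbs-∧ _ _) (B.∨-absorbs-∧ _ _)
  ; 𝟘-least      = λ x → cong₂ _,_ (A.𝟘-least _) (B.𝟘-least _)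
  ; 𝟙-greatest   = λ x → cong₂ _,_ (A.𝟙-greatest _) (B.𝟙-greatest _)
  ; ⊙-comm       = λ x y → cong₂ _,_ (A.⊙-comm _ _) (B.⊙-comm _ _)
  ; ⊙-assoc      = λ x y z → cong₂ _,_ (A.⊙-assoc _ _ _) (B.⊙-assoc _ _ _)
  ; ⊙-identityʳ  = λ x → cong₂ _,_ (A.⊙-identityʳ _) (B.⊙-identityʳ _)
  ; residuation  = λ x y z →
      let module Rᴬ = Equivalence (A.residuation (x .proj₁) (y .proj₁) (z .proj₁))
          module Rᴮ = Equivalence (B.residuation (x .proj₂) (y .proj₂) (z .proj₂))
      in mk⇔ (λ e → cong₂ _,_ (Rᴬ.to (cong proj₁ e)) (Rᴮ.to (cong proj₂ e)))
             (λ e → cong₂ _,_ (Rᴬ.from (cong proj₁ e)) (Rᴮ.from (cong proj₂ e)))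
  ; divisibility = λ x y → cong₂ _,_ (A.divisibility _ _) (B.divisibility _ _)
  ; prelinearity = λ x y → cong₂ _,_ (A.prelinearity _ _) (B.prelinearity _ _)
  }
  where
  module A = BLAlgebra A
  module B = BLAlgebra B

module Łukasiewicz where
  open import Data.Sum using (inj₁; inj₂)
  open import Data.Rational
  open import Data.Rational.Properties
  open import Data.Rational.Solver using (module +-*-Solver)
  open +-*-Solver using (solve; _:+_; _:-_; con; _:=_)

  _⊙ᴸ_ _⇒ᴸ_ : ℚ → ℚ → ℚ
  x ⊙ᴸ y = 0ℚ ⊔ (x + y - 1ℚ)
  x ⇒ᴸ y = 1ℚ ⊓ (1ℚ - x + y)

  0≤1 : 0ℚ ≤ 1ℚ
  0≤1 = nonNegative⁻¹ 1ℚ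

  1-x+x≡1 : ∀ x → 1ℚ - x + x ≡ 1ℚ
  1-x+x≡1 = solve 1 (λ x → con 1ℚ :- x :+ x := con 1ℚ) refl

  x+[1-x]-1≡0 : ∀ x → x + (1ℚ - x) - 1ℚ ≡ 0ℚ
  x+[1-x]-1≡0 = solve 1 (λ x → x :+ (con 1ℚ :- x) :- con 1ℚ := con 0ℚ) refl

  ⇒ᴸ-affine : ∀ x y → x ⇒ᴸ y ≡ 1ℚ - x + x ⊓ y
  ⇒ᴸ-affine x y = begin
    1ℚ ⊓ (1ℚ - x + y)             ≡⟨ cong (_⊓ (1ℚ - x + y)) (sym (1-x+x≡1 x)) ⟩
    (1ℚ - x + x) ⊓ (1ℚ - x + y)   ≡⟨ sym (mono-≤-distrib-⊓ (+-monoʳ-≤ (1ℚ - x)) x y) ⟩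
    1ℚ - x + x ⊓ y                ∎
    where open ≡-Reasoning

  ⊙ᴸ-affine : ∀ x y → x ⊙ᴸ y ≡ x + ((1ℚ - x) ⊔ y) - 1ℚ
  ⊙ᴸ-affine x y = begin
    0ℚ ⊔ (x + y - 1ℚ)                     ≡⟨ cong (_⊔ (x + y - 1ℚ)) (sym (x+[1-x]-1≡0 x)) ⟩
    (x + (1ℚ - x) - 1ℚ) ⊔ (x + y - 1ℚ)    ≡⟨ sym (mono-≤-distrib-⊔ (λ h → +-monoˡ-≤ (- 1ℚ) (+-monoʳ-≤ x h)) (1ℚ - x) y) ⟩
    x + ((1ℚ - x) ⊔ y) - 1ℚ               ∎
    where open ≡-Reasoning

  x⇒ᴸ0≡1-x : ∀ {x} → 0ℚ ≤ x → x ⇒ᴸ 0ℚ ≡ 1ℚ - x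
  x⇒ᴸ0≡1-x {x} 0≤x = begin
    x ⇒ᴸ 0ℚ            ≡⟨ ⇒ᴸ-affine x 0ℚ ⟩
    1ℚ - x + x ⊓ 0ℚ    ≡⟨ cong (1ℚ - x +_) (p≥q⇒p⊓q≡q 0≤x) ⟩
    1ℚ - x + 0ℚ        ≡⟨ +-identityʳ (1ℚ - x) ⟩
    1ℚ - x             ∎
    where open ≡-Reasoning

  x+1-1≡x : ∀ x → x + 1ℚ - 1ℚ ≡ x
  x+1-1≡x = solve 1 (λ x → x :+ con 1ℚ :- con 1ℚ := x) refl

  x+[1-x+m]-1≡m : ∀ x m → x + (1ℚ - x + m) - 1ℚ ≡ m
  x+[1-x+m]-1≡m = solve 2 (λ x m → x :+ (con 1ℚ :- x :+ m) :- con 1ℚ := m) refl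

  x+z-1+[1-x]≡z : ∀ x z → x + z - 1ℚ + (1ℚ - x) ≡ z
  x+z-1+[1-x]≡z = solve 2 (λ x z → x :+ z :- con 1ℚ :+ (con 1ℚ :- x) := z) refl

  ⊙ᴸ-comm : ∀ x y → x ⊙ᴸ y ≡ y ⊙ᴸ x
  ⊙ᴸ-comm x y = cong (λ s → 0ℚ ⊔ (s - 1ℚ)) (+-comm x y)

  ⊙ᴸ-identityʳ : ∀ {x} → 0ℚ ≤ x → x ⊙ᴸ 1ℚ ≡ x
  ⊙ᴸ-identityʳ {x} 0≤x = trans (cong (0ℚ ⊔_) (x+1-1≡x x)) (p≤q⇒p⊔q≡q 0≤x)

  0⊔[[0⊔p]+z-1]≡0⊔[p+z-1] : ∀ p {z} → z ≤ 1ℚ → 0ℚ ⊔ ((0ℚ ⊔ p) + z - 1ℚ) ≡ 0ℚ ⊔ (p + z - 1ℚ)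
  0⊔[[0⊔p]+z-1]≡0⊔[p+z-1] p {z} z≤1 = begin
    0ℚ ⊔ ((0ℚ ⊔ p) + z - 1ℚ)                ≡⟨ cong (0ℚ ⊔_) (mono-≤-distrib-⊔ shift 0ℚ p) ⟩
    0ℚ ⊔ ((0ℚ + z - 1ℚ) ⊔ (p + z - 1ℚ))     ≡⟨ sym (⊔-assoc 0ℚ (0ℚ + z - 1ℚ) (p + z - 1ℚ)) ⟩
    (0ℚ ⊔ (0ℚ + z - 1ℚ)) ⊔ (p + z - 1ℚ)     ≡⟨ cong (_⊔ (p + z - 1ℚ)) (p≥q⇒p⊔q≡p z-1≤0) ⟩
    0ℚ ⊔ (p + z - 1ℚ)                       ∎
    where
      open ≡-Reasoning
      shift : ∀ {q r} → q ≤ r → q + z - 1ℚ ≤ r + z - 1ℚ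
      shift q≤r = +-monoˡ-≤ (- 1ℚ) (+-monoˡ-≤ z q≤r)
      z-1≤0 : 0ℚ + z - 1ℚ ≤ 0ℚ
      z-1≤0 = +-monoˡ-≤ (- 1ℚ) (+-monoʳ-≤ 0ℚ z≤1)

  ⊙ᴸ-assoc : ∀ {x} y {z} → x ≤ 1ℚ → z ≤ 1ℚ → (x ⊙ᴸ y) ⊙ᴸ z ≡ x ⊙ᴸ (y ⊙ᴸ z)
  ⊙ᴸ-assoc {x} y {z} x≤1 z≤1 = begin
    0ℚ ⊔ ((0ℚ ⊔ (x + y - 1ℚ)) + z - 1ℚ)   ≡⟨ 0⊔[[0⊔p]+z-1]≡0⊔[p+z-1] (x + y - 1ℚ) z≤1 ⟩
    0ℚ ⊔ (x + y - 1ℚ + z - 1ℚ)            ≡⟨ cong (0ℚ ⊔_) (regroup x y z) ⟩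
    0ℚ ⊔ (y + z - 1ℚ + x - 1ℚ)            ≡⟨ sym (0⊔[[0⊔p]+z-1]≡0⊔[p+z-1] (y + z - 1ℚ) x≤1) ⟩
    (y ⊙ᴸ z) ⊙ᴸ x                         ≡⟨ ⊙ᴸ-comm (y ⊙ᴸ z) x ⟩
    x ⊙ᴸ (y ⊙ᴸ z)                         ∎
    where
      open ≡-Reasoning
      regroup : ∀ x y z → x + y - 1ℚ + z - 1ℚ ≡ y + z - 1ℚ + x - 1ℚ
      regroup = solve 3 (λ x y z → x :+ y :- con 1ℚ :+ z :- con 1ℚ := y :+ z :- con 1ℚ :+ x :- con 1ℚ) refl

  x+z-1≤y⇒z≤1-x+y : ∀ x y z → x + z - 1ℚ ≤ y → z ≤ 1ℚ - x + y
  x+z-1≤y⇒z≤1-x+y x y z h = begin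
    z                        ≡⟨ sym (x+z-1+[1-x]≡z x z) ⟩
    x + z - 1ℚ + (1ℚ - x)    ≤⟨ +-monoˡ-≤ (1ℚ - x) h ⟩
    y + (1ℚ - x)             ≡⟨ +-comm y (1ℚ - x) ⟩
    1ℚ - x + y               ∎
    where open ≤-Reasoning

  z≤1-x+y⇒x+z-1≤y : ∀ x y z → z ≤ 1ℚ - x + y → x + z - 1ℚ ≤ y
  z≤1-x+y⇒x+z-1≤y x y z h = begin
    x + z - 1ℚ                 ≤⟨ +-monoˡ-≤ (- 1ℚ) (+-monoʳ-≤ x h) ⟩
    x + (1ℚ - x + y) - 1ℚ      ≡⟨ x+[1-x+m]-1≡m x y ⟩
    y                          ∎
    where open ≤-Reasoning

  ⊙ᴸ-residual-to : ∀ x {y z} → 0ℚ ≤ y → z ≤ x ⇒ᴸ y → x ⊙ᴸ z ≤ y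
  ⊙ᴸ-residual-to x {y} {z} 0≤y h =
    ⊔-lub 0≤y (z≤1-x+y⇒x+z-1≤y x y z (p≤q⊓r⇒p≤r 1ℚ (1ℚ - x + y) h))

  ⊙ᴸ-residual-from : ∀ x {y z} → z ≤ 1ℚ → x ⊙ᴸ z ≤ y → z ≤ x ⇒ᴸ y
  ⊙ᴸ-residual-from x {y} {z} z≤1 h =
    ⊓-glb z≤1 (x+z-1≤y⇒z≤1-x+y x y z (p⊔q≤r⇒q≤r 0ℚ (x + z - 1ℚ) h))

  ⊙ᴸ-divisibility : ∀ {x y} → 0ℚ ≤ x → 0ℚ ≤ y → x ⊓ y ≡ x ⊙ᴸ (x ⇒ᴸ y)
  ⊙ᴸ-divisibility {x} {y} 0≤x 0≤y = sym (begin
    0ℚ ⊔ (x + x ⇒ᴸ y - 1ℚ)              ≡⟨ cong (λ w → 0ℚ ⊔ (x + w - 1ℚ)) (⇒ᴸ-affine x y) ⟩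
    0ℚ ⊔ (x + (1ℚ - x + x ⊓ y) - 1ℚ)    ≡⟨ cong (0ℚ ⊔_) (x+[1-x+m]-1≡m x (x ⊓ y)) ⟩
    0ℚ ⊔ x ⊓ y                          ≡⟨ p≤q⇒p⊔q≡q (⊓-glb 0≤x 0≤y) ⟩
    x ⊓ y                               ∎)
    where open ≡-Reasoning

  x≤y⇒x⇒ᴸy≡1 : ∀ {x y} → x ≤ y → x ⇒ᴸ y ≡ 1ℚ
  x≤y⇒x⇒ᴸy≡1 {x} {y} x≤y = begin
    x ⇒ᴸ y            ≡⟨ ⇒ᴸ-affine x y ⟩
    1ℚ - x + x ⊓ y    ≡⟨ cong (1ℚ - x +_) (p≤q⇒p⊓q≡p x≤y) ⟩
    1ℚ - x + x        ≡⟨ 1-x+x≡1 x ⟩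
    1ℚ                ∎
    where open ≡-Reasoning

  ⇒ᴸ-prelinearity : ∀ x y → x ⇒ᴸ y ⊔ y ⇒ᴸ x ≡ 1ℚ
  ⇒ᴸ-prelinearity x y with ≤-total x y
  ... | inj₁ x≤y = trans (cong (_⊔ y ⇒ᴸ x) (x≤y⇒x⇒ᴸy≡1 x≤y)) (p≥q⇒p⊔q≡p (p⊓q≤p 1ℚ (1ℚ - y + x)))
  ... | inj₂ y≤x = trans (cong (x ⇒ᴸ y ⊔_) (x≤y⇒x⇒ᴸy≡1 y≤x)) (p≤q⇒p⊔q≡q (p⊓q≤p 1ℚ (1ℚ - x + y)))

  ⊙ᴸ-nonNeg : ∀ x y → 0ℚ ≤ x ⊙ᴸ y
  ⊙ᴸ-nonNeg x y = p≤p⊔q 0ℚ (x + y - 1ℚ)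

  ⊙ᴸ-≤1 : ∀ {x y} → x ≤ 1ℚ → y ≤ 1ℚ → x ⊙ᴸ y ≤ 1ℚ
  ⊙ᴸ-≤1 {x} {y} x≤1 y≤1 = ⊔-lub 0≤1 (begin
    x + y - 1ℚ      ≤⟨ +-monoˡ-≤ (- 1ℚ) (+-monoˡ-≤ y x≤1) ⟩
    1ℚ + y - 1ℚ     ≡⟨ cong (_- 1ℚ) (+-comm 1ℚ y) ⟩
    y + 1ℚ - 1ℚ     ≡⟨ x+1-1≡x y ⟩
    y               ≤⟨ y≤1 ⟩
    1ℚ              ∎)
    where open ≤-Reasoning

  ⇒ᴸ-nonNeg : ∀ {x y} → x ≤ 1ℚ → 0ℚ ≤ y → 0ℚ ≤ x ⇒ᴸ y
  ⇒ᴸ-nonNeg x≤1 0≤y = ⊓-glb 0≤1 (+-mono-≤ (+-monoʳ-≤ 1ℚ (neg-antimono-≤ x≤1)) 0≤y)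

  ⇒ᴸ-≤1 : ∀ x y → x ⇒ᴸ y ≤ 1ℚ
  ⇒ᴸ-≤1 x y = p⊓q≤p 1ℚ (1ℚ - x + y)

  𝕀 : Set
  𝕀 = Σ ℚ λ q → 0ℚ ≤ q × q ≤ 1ℚ

  val : 𝕀 → ℚ
  val = proj₁

  val-nonNeg : (a : 𝕀) → 0ℚ ≤ val a
  val-nonNeg a = proj₁ (proj₂ a)

  val-≤1 : (a : 𝕀) → val a ≤ 1ℚ
  val-≤1 a = proj₂ (proj₂ a)

  val-injective : ∀ {a b} → val a ≡ val b → a ≡ b
  val-injective {q , 0≤q , q≤1} {.q , 0≤q′ , q≤1′} refl =
    cong₂ (λ l u → q , l , u) (≤-irrelevant 0≤q 0≤q′) (≤-irrelevant q≤1 q≤1′)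

  𝟘ᴵ 𝟙ᴵ : 𝕀
  𝟘ᴵ = 0ℚ , ≤-refl , 0≤1
  𝟙ᴵ = 1ℚ , 0≤1 , ≤-refl

  _∧ᴵ_ _∨ᴵ_ _⊙ᴵ_ _⇒ᴵ_ : 𝕀 → 𝕀 → 𝕀
  a ∧ᴵ b = val a ⊓ val b , ⊓-glb (val-nonNeg a) (val-nonNeg b) , p≤q⇒p⊓r≤q (val b) (val-≤1 a)
  a ∨ᴵ b = val a ⊔ val b , p≤q⇒p≤q⊔r (val b) (val-nonNeg a) , ⊔-lub (val-≤1 a) (val-≤1 b)
  a ⊙ᴵ b = val a ⊙ᴸ val b , ⊙ᴸ-nonNeg (val a) (val b) , ⊙ᴸ-≤1 (val-≤1 a) (val-≤1 b)
  a ⇒ᴵ b = val a ⇒ᴸ val b , ⇒ᴸ-nonNeg (val-≤1 a) (val-nonNeg b) , ⇒ᴸ-≤1 (val a) (val b)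

  ∧ᴵ-≡⇒≤ : ∀ {a b} → a ∧ᴵ b ≡ a → val a ≤ val b
  ∧ᴵ-≡⇒≤ e = p⊓q≡p⇒p≤q (cong val e)

  ≤⇒∧ᴵ-≡ : ∀ {a b} → val a ≤ val b → a ∧ᴵ b ≡ a
  ≤⇒∧ᴵ-≡ a≤b = val-injective (p≤q⇒p⊓q≡p a≤b)

  unitInterval : BLAlgebra 0ℓ
  unitInterval = record
    { Carrier      = 𝕀
    ; _∧_ = _∧ᴵ_ ; _∨_ = _∨ᴵ_ ; _⊙_ = _⊙ᴵ_ ; _⇒_ = _⇒ᴵ_ ; 𝟘 = 𝟘ᴵ ; 𝟙 = 𝟙ᴵ
    ; ∧-comm       = λ a b → val-injective (⊓-comm (val a) (val b))
    ; ∨-comm       = λ a b → val-injective (⊔-comm (val a) (val b))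
    ; ∧-assoc      = λ a b c → val-injective (⊓-assoc (val a) (val b) (val c))
    ; ∨-assoc      = λ a b c → val-injective (⊔-assoc (val a) (val b) (val c))
    ; ∧-absorbs-∨  = λ a b → val-injective (⊓-absorbs-⊔ (val a) (val b))
    ; ∨-absorbs-∧  = λ a b → val-injective (⊔-absorbs-⊓ (val a) (val b))
    ; 𝟘-least      = λ a → ≤⇒∧ᴵ-≡ {𝟘ᴵ} {a} (val-nonNeg a)
    ; 𝟙-greatest   = λ a → ≤⇒∧ᴵ-≡ {a} {𝟙ᴵ} (val-≤1 a)
    ; ⊙-comm       = λ a b → val-injective (⊙ᴸ-comm (val a) (val b))
    ; ⊙-assoc      = λ a b c → val-injective (⊙ᴸ-assoc (val b) (val-≤1 a) (val-≤1 c))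
    ; ⊙-identityʳ  = λ a → val-injective (⊙ᴸ-identityʳ (val-nonNeg a))
    ; residuation  = λ a b c → mk⇔
        (λ c≤a⇒b → ≤⇒∧ᴵ-≡ {a ⊙ᴵ c} {b}
          (⊙ᴸ-residual-to (val a) (val-nonNeg b) (∧ᴵ-≡⇒≤ {c} {a ⇒ᴵ b} c≤a⇒b)))
        (λ a⊙c≤b → ≤⇒∧ᴵ-≡ {c} {a ⇒ᴵ b}
          (⊙ᴸ-residual-from (val a) (val-≤1 c) (∧ᴵ-≡⇒≤ {a ⊙ᴵ c} {b} a⊙c≤b)))
    ; divisibility = λ a b → val-injective (⊙ᴸ-divisibility (val-nonNeg a) (val-nonNeg b))
    ; prelinearity = λ a b → val-injective (⇒ᴸ-prelinearity (val a) (val b))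
    }

module AveragingState where
  open import Data.Rational
  open import Data.Rational.Properties
  open import Data.Rational.Solver using (module +-*-Solver)
  open +-*-Solver using (solve; _:+_; _:-_; _:*_; con; _:=_)
  open Łukasiewicz

  avg : ℚ → ℚ → ℚ
  avg p q = (p + q) * ½

  avg-mono-≤ : ∀ {p p′ q q′} → p ≤ p′ → q ≤ q′ → avg p q ≤ avg p′ q′
  avg-mono-≤ p≤p′ q≤q′ = *-monoʳ-≤-nonNeg ½ (+-mono-≤ p≤p′ q≤q′)

  avg-idem : ∀ p → avg p p ≡ p
  avg-idem = solve 1 (λ p → (p :+ p) :* con ½ := p) refl

  avg-[1-x+m] : ∀ x₁ x₂ m₁ m₂ → avg (1ℚ - x₁ + m₁) (1ℚ - x₂ + m₂) ≡ 1ℚ - avg x₁ x₂ + avg m₁ m₂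
  avg-[1-x+m] = solve 4 (λ x₁ x₂ m₁ m₂ →
    (con 1ℚ :- x₁ :+ m₁ :+ (con 1ℚ :- x₂ :+ m₂)) :* con ½
      := con 1ℚ :- (x₁ :+ x₂) :* con ½ :+ (m₁ :+ m₂) :* con ½) refl

  avg-[x+z-1] : ∀ x₁ x₂ z₁ z₂ → avg (x₁ + z₁ - 1ℚ) (x₂ + z₂ - 1ℚ) ≡ avg x₁ x₂ + avg z₁ z₂ - 1ℚ
  avg-[x+z-1] = solve 4 (λ x₁ x₂ z₁ z₂ →
    (x₁ :+ z₁ :- con 1ℚ :+ (x₂ :+ z₂ :- con 1ℚ)) :* con ½
      := (x₁ :+ x₂) :* con ½ :+ (z₁ :+ z₂) :* con ½ :- con 1ℚ) refl

  avg-⇒ᴸ : ∀ x₁ x₂ y₁ y₂ → avg (x₁ ⇒ᴸ y₁) (x₂ ⇒ᴸ y₂) ≡ avg x₁ x₂ ⇒ᴸ avg (x₁ ⊓ y₁) (x₂ ⊓ y₂)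
  avg-⇒ᴸ x₁ x₂ y₁ y₂ = begin
    avg (x₁ ⇒ᴸ y₁) (x₂ ⇒ᴸ y₂)                      ≡⟨ cong₂ avg (⇒ᴸ-affine x₁ y₁) (⇒ᴸ-affine x₂ y₂) ⟩
    avg (1ℚ - x₁ + x₁ ⊓ y₁) (1ℚ - x₂ + x₂ ⊓ y₂)    ≡⟨ avg-[1-x+m] x₁ x₂ (x₁ ⊓ y₁) (x₂ ⊓ y₂) ⟩
    1ℚ - x̄ + m̄                                      ≡⟨ cong (1ℚ - x̄ +_) (sym (p≥q⇒p⊓q≡q m̄≤x̄)) ⟩
    1ℚ - x̄ + x̄ ⊓ m̄                                  ≡⟨ sym (⇒ᴸ-affine x̄ m̄) ⟩
    x̄ ⇒ᴸ m̄                                          ∎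
    where
      open ≡-Reasoning
      x̄ = avg x₁ x₂
      m̄ = avg (x₁ ⊓ y₁) (x₂ ⊓ y₂)
      m̄≤x̄ : m̄ ≤ x̄
      m̄≤x̄ = avg-mono-≤ (p⊓q≤p x₁ y₁) (p⊓q≤p x₂ y₂)

  avg-⊙ᴸ : ∀ x₁ x₂ y₁ y₂ → avg (x₁ ⊙ᴸ y₁) (x₂ ⊙ᴸ y₂) ≡ avg x₁ x₂ ⊙ᴸ avg ((1ℚ - x₁) ⊔ y₁) ((1ℚ - x₂) ⊔ y₂)
  avg-⊙ᴸ x₁ x₂ y₁ y₂ = sym (begin
    0ℚ ⊔ (avg x₁ x₂ + avg z₁ z₂ - 1ℚ)             ≡⟨ cong (0ℚ ⊔_) (sym (avg-[x+z-1] x₁ x₂ z₁ z₂)) ⟩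
    0ℚ ⊔ avg (x₁ + z₁ - 1ℚ) (x₂ + z₂ - 1ℚ)        ≡⟨ cong (0ℚ ⊔_) (sym (cong₂ avg (⊙ᴸ-affine x₁ y₁) (⊙ᴸ-affine x₂ y₂))) ⟩
    0ℚ ⊔ avg (x₁ ⊙ᴸ y₁) (x₂ ⊙ᴸ y₂)                ≡⟨ p≤q⇒p⊔q≡q (avg-mono-≤ (⊙ᴸ-nonNeg x₁ y₁) (⊙ᴸ-nonNeg x₂ y₂)) ⟩
    avg (x₁ ⊙ᴸ y₁) (x₂ ⊙ᴸ y₂)                     ∎)
    where
      open ≡-Reasoning
      z₁ = (1ℚ - x₁) ⊔ y₁
      z₂ = (1ℚ - x₂) ⊔ y₂

  avgᴵ : 𝕀 → 𝕀 → 𝕀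
  avgᴵ a b = avg (val a) (val b)
           , avg-mono-≤ (val-nonNeg a) (val-nonNeg b) , avg-mono-≤ (val-≤1 a) (val-≤1 b)

  square : BLAlgebra 0ℓ
  square = unitInterval ×ᴮᴸ unitInterval

  diagonal : 𝕀 → 𝕀 × 𝕀
  diagonal c = c , c

  σ : 𝕀 × 𝕀 → 𝕀 × 𝕀
  σ (a , b) = diagonal (avgᴵ a b)

  σ-diagonal : ∀ c → σ (diagonal c) ≡ diagonal c
  σ-diagonal c = cong diagonal (val-injective (avg-idem (val c)))

  σ-cond1 : Cond1 square σ
  σ-cond1 = σ-diagonal 𝟘ᴵ

  σ-cond2 : Cond2 square σ
  σ-cond2 (x₁ , x₂) (y₁ , y₂) = cong diagonal (val-injective (avg-⇒ᴸ (val x₁) (val x₂) (val y₁) (val y₂)))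

  σ-cond3' : Cond3' square σ
  σ-cond3' (x₁ , x₂) (y₁ , y₂) = cong diagonal (val-injective (begin
    avg (val x₁ ⊙ᴸ val y₁) (val x₂ ⊙ᴸ val y₂)
      ≡⟨ avg-⊙ᴸ (val x₁) (val x₂) (val y₁) (val y₂) ⟩
    avg (val x₁) (val x₂) ⊙ᴸ avg ((1ℚ - val x₁) ⊔ val y₁) ((1ℚ - val x₂) ⊔ val y₂)
      ≡⟨ cong₂ (λ n₁ n₂ → avg (val x₁) (val x₂) ⊙ᴸ avg (n₁ ⊔ val y₁) (n₂ ⊔ val y₂))
               (sym (x⇒ᴸ0≡1-x (val-nonNeg x₁))) (sym (x⇒ᴸ0≡1-x (val-nonNeg x₂))) ⟩
    avg (val x₁) (val x₂) ⊙ᴸ avg ((val x₁ ⇒ᴸ 0ℚ) ⊔ val y₁) ((val x₂ ⇒ᴸ 0ℚ) ⊔ val y₂) ∎))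
    where open ≡-Reasoning

  σ-cond4 : Cond4 square σ
  σ-cond4 x y = σ-diagonal _

  σ-cond5 : Cond5 square σ
  σ-cond5 x y = σ-diagonal _

  σ-not-cond6 : ¬ Cond6 square σ
  σ-not-cond6 σ⊙ = ½≢0 (cong (λ p → val (p .proj₁)) (σ⊙ (𝟙ᴵ , 𝟘ᴵ) (𝟙ᴵ , 𝟘ᴵ)))
    where
      ½≢0 : ½ ≢ 0ℚ
      ½≢0 ()

  σ-isStrongStateOperator : IsStrongStateOperator square σ
  σ-isStrongStateOperator = σ-cond1 , σ-cond2 , σ-cond3' , σ-cond4 , σ-cond5

  σ-notMorphismStateOperator : ¬ IsMorphismStateOperator square σ
  σ-notMorphismStateOperator (_ , _ , _ , _ , σ⊙) = σ-not-cond6 σ⊙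

proposition3p16 : ((A : BLAlgebra 0ℓ) (σ : BLAlgebra.Carrier A → BLAlgebra.Carrier A) →
    IsMorphismStateOperator A σ → IsStrongStateOperator A σ)
    × Σ (BLAlgebra 0ℓ) (λ A → Σ (BLAlgebra.Carrier A → BLAlgebra.Carrier A) (λ σ →
    IsStrongStateOperator A σ × ¬ IsMorphismStateOperator A σ))
proposition3p16 =
  morphismState⇒strongState ,
  (square , σ , σ-isStrongStateOperator , σ-notMorphismStateOperator)
  where open AveragingState
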